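{- Let $p,q \in (0,1]$ and let $\overline{\mathbf{T}}$ be the output of the following algorithm $\mathcal{A}(p,q)$ run on the edge stream of $G$. Then $\mathbb{E}[\overline{\mathbf{T}}] = T$, where $T$ is the number of triangles in $G$. Algorithm $\mathcal{A}(p,q)$: choose a pairwise independent random function $\mathbf{f}: V\to\{0,1\}$ with $\Pr[\mathbf{f}(v)=1]=p$ for each $v\in V$, and a fully independent random function $\mathbf{g}: E\to\{0,1\}$ with $\Pr[\mathbf{g}(e)=1]=q$ for each $e\in E$. Initialize $S\gets\emptyset$ and $\overline{\mathbf{T}}\gets 0$. For each stream update $wv$: first, for every $u\in V$ with $\mathbf{f}(u)=1$ and $uv, uw \in S$, increase $\overline{\mathbf{T}}$ by $1/(pq^2)$; then, if $\mathbf{g}(wv)\,(\mathbf{f}(w)+\mathbf{f}(v))>0$, add $wv$ to $S$. At the end of the stream output $\overline{\mathbf{T}}$.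
   Context: A simple undirected graph $G=(V,E)$ is received as an insertion-only stream of its edges, each appearing once, in arbitrary order. A triangle is a set of three pairwise adjacent vertices.
   Formalization: The parameters p and q are rationals in (0,1], and the distribution of the random function f has rational probability weights. -}

module Defs where

open import Data.Bool using (Bool; true; false; _∧_; _∨_; if_then_else_)
import Data.Bool as B
open import Data.Nat using (ℕ; zero; suc)
open import Data.Fin using (Fin)
import Data.Fin as F
open import Data.Product using (_×_; _,_; proj₁; proj₂)
open import Data.List using (List; []; _∷_; length; map; foldr; allFin; filter)
open import Data.List.Relation.Unary.All using (All)
open import Data.List.Relation.Unary.AllPairs using (AllPairs)
open import Data.Vec using (Vec; []; _∷_)
open import Data.Rational using (ℚ; 0ℚ; 1ℚ; _+_; _*_; _-_; _≤_; _<_; _>_; 1/_; Positive; positive; _/_)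
open import Data.Rational.Properties using (pos*pos⇒pos; pos⇒nonZero)
open import Relation.Binary.PropositionalEquality using (_≡_; _≢_)
open import Relation.Nullary using (¬_)
open import Relation.Nullary.Decidable using (⌊_⌋)

Edge : ℕ → Set
Edge n = Fin n × Fin n

Stream : ℕ → Set
Stream n = List (Edge n)

SameEdge : ∀ {n} → Edge n → Edge n → Set
SameEdge (a , b) (c , d) = (a ≡ c × b ≡ d) ⊎' (a ≡ d × b ≡ c)
  where
  open import Data.Sum using () renaming (_⊎_ to _⊎'_)

isEdge : ∀ {n} → Fin n → Fin n → Edge n → Bool
isEdge x y (a , b) = (⌊ a F.≟ x ⌋ ∧ ⌊ b F.≟ y ⌋) ∨ (⌊ a F.≟ y ⌋ ∧ ⌊ b F.≟ x ⌋)

memb : ∀ {n} → Fin n → Fin n → List (Edge n) → Bool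
memb x y []       = false
memb x y (e ∷ es) = isEdge x y e ∨ memb x y es

SimpleStream : ∀ {n} → Stream n → Set
SimpleStream σ = All (λ e → proj₁ e ≢ proj₂ e) σ × AllPairs (λ e e' → ¬ SameEdge e e') σ

adj : ∀ {n} → Stream n → Fin n → Fin n → Bool
adj σ x y = memb x y σ

triangles : ∀ {n} → Stream n → ℕ
triangles {n} σ =
  length (filter (λ t → let u = proj₁ t ; v = proj₁ (proj₂ t) ; w = proj₂ (proj₂ t) in
                          F._<?_ u v ×-dec F._<?_ v w ×-dec
                          B.T? (adj σ u v ∧ adj σ v w ∧ adj σ u w))
                 triples)
  where
  open import Relation.Nullary.Decidable using (_×-dec_)
  open import Data.List using (cartesianProduct)
  triples : List (Fin n × Fin n × Fin n)
  triples = cartesianProduct (allFin n) (cartesianProduct (allFin n) (allFin n))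

sumℚ : List ℚ → ℚ
sumℚ = foldr _+_ 0ℚ

-- A probability distribution on random functions f : V → {0,1}
-- (the space of such functions is finite, so every distribution is a
-- finite list of weighted outcomes).
Dist : ℕ → Set
Dist n = List (ℚ × (Fin n → Bool))

Pr : ∀ {n} → Dist n → ((Fin n → Bool) → Bool) → ℚ
Pr D P = sumℚ (map (λ wf → if P (proj₂ wf) then proj₁ wf else 0ℚ) D)

IsDist : ∀ {n} → Dist n → Set
IsDist D = All (λ wf → 0ℚ ≤ proj₁ wf) D × sumℚ (map proj₁ D) ≡ 1ℚ

Marginals : ∀ {n} → Dist n → ℚ → Set
Marginals {n} D p = (v : Fin n) → Pr D (λ f → f v) ≡ p

PairwiseIndependent : ∀ {n} → Dist n → Set
PairwiseIndependent {n} D =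
  (u v : Fin n) → u ≢ v → (a b : Bool) →
  Pr D (λ f → ⌊ f u B.≟ a ⌋ ∧ ⌊ f v B.≟ b ⌋)
    ≡ Pr D (λ f → ⌊ f u B.≟ a ⌋) * Pr D (λ f → ⌊ f v B.≟ b ⌋)

-- Expectation of h(g) where g = (g_1,…,g_m) are fully independent
-- Bernoulli(q) bits (g_i is the value of g on the i-th edge of the stream).
EBern : (q : ℚ) (m : ℕ) → (Vec Bool m → ℚ) → ℚ
EBern q zero    h = h []
EBern q (suc m) h = q * EBern q m (λ g → h (true ∷ g))
                  + (1ℚ - q) * EBern q m (λ g → h (false ∷ g))

EDist : ∀ {n} → Dist n → ((Fin n → Bool) → ℚ) → ℚ
EDist D h = sumℚ (map (λ wf → proj₁ wf * h (proj₂ wf)) D)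

-- The algorithm A(p,q), with increment c = 1/(p q²), run with fixed
-- values of f and g.  State: (S, T̄).

Stateℚ : ℕ → Set
Stateℚ n = List (Edge n) × ℚ

step : ∀ {n} → ℚ → (Fin n → Bool) → Bool → Edge n → Stateℚ n → Stateℚ n
step {n} c f gb (w , v) (S , T) =
  let T' = sumℚ (map (λ u → if f u ∧ memb u v S ∧ memb u w S then c else 0ℚ) (allFin n)) + T
      S' = if gb ∧ (f w ∨ f v) then (w , v) ∷ S else S
  in  S' , T'

run : ∀ {n} → ℚ → (Fin n → Bool) → (σ : Stream n) → Vec Bool (length σ) → Stateℚ n → Stateℚ n
run c f []       []       st = st
run c f (e ∷ σ)  (b ∷ g)  st = run c f σ g (step c f b e st)

output : ∀ {n} → ℚ → (Fin n → Bool) → (σ : Stream n) → Vec Bool (length σ) → ℚ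
output c f σ g = proj₂ (run c f σ g ([] , 0ℚ))

incr : (p q : ℚ) → p > 0ℚ → q > 0ℚ → ℚ
incr p q p>0 q>0 = (1/ (p * q * q)) {{pos⇒nonZero (p * q * q) {{pq²>0}}}}
  where
  instance
    pp : Positive p
    pp = positive p>0
    qp : Positive q
    qp = positive q>0
  pq²>0 : Positive (p * q * q)
  pq²>0 = pos*pos⇒pos (p * q) {{pos*pos⇒pos p q}} q

expectedOutput : ∀ {n} (p q : ℚ) → p > 0ℚ → q > 0ℚ → Dist n → Stream n → ℚ
expectedOutput p q p>0 q>0 D σ =
  EDist D (λ f → EBern q (length σ) (λ g → output (incr p q p>0 q>0) f σ g))

-- Fix f and average over the coins g first. Replace the stored set S by weights W, W x y being the
-- probability that xy is stored. The expected remaining output is then affine in the weight of every edge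
-- that does not arrive again, since an increment multiplies the weights of two distinct edges. So the
-- coin of an arriving edge wv just gives it the weight q [f w ∨ f v]. A wedge with apex u is counted only
-- if f u = 1, and then both its edges have weight q: its expected contribution is 1/(p q²) · q² · p = 1.
-- Hence E[T̄] is the sum, over the arriving edges wv, of the number of common neighbours of w and v among
-- the earlier edges, which counts each triangle exactly once, at the arrival of its last edge.

module Submission where

open import Defs
open import Data.Nat using (ℕ)
open import Data.Integer using (+_)
open import Data.Rational using (ℚ; 0ℚ; 1ℚ; _≤_; _<_; _/_)
open import Relation.Binary.PropositionalEquality using (_≡_)

open import Algebra.Bundles using (CommutativeMonoid)
open import Algebra.Properties.CommutativeSemigroup using (interchange)
open import Data.Bool using (Bool; true; false; T; _∧_; _∨_; if_then_else_)
import Data.Bool.Properties as 𝔹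
open import Data.Empty using (⊥; ⊥-elim)
open import Data.Fin as F using (Fin)
import Data.Fin.Properties as FP
import Data.Integer as ℤ
import Data.Integer.Properties as ℤP
open import Data.List using (List; []; _∷_; length; map; allFin; filter; cartesianProduct; tabulate)
import Data.List.Properties as LP
open import Data.List.Relation.Unary.All using (All; []; _∷_)
open import Data.List.Relation.Unary.AllPairs using (_∷_)
import Data.Nat as ℕ
import Data.Nat.Coprimality as Coprimality
open import Data.Nat.ListAction using (sum)
import Data.Nat.ListAction.Properties as ℕL
import Data.Nat.Properties as ℕP
open import Data.Product using (_×_; _,_; proj₁; proj₂)
open import Data.Rational using (_+_; _*_; _-_; Positive; positive; NonZero; mkℚ)
import Data.Rational.Properties as ℚP
open import Data.Sum using (inj₁; inj₂)
open import Data.Vec using (Vec; []; _∷_)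
open import Function using (_∘_)
open import Relation.Binary using (tri<; tri≈; tri>)
open import Relation.Binary.PropositionalEquality using (refl; sym; trans; cong; cong₂; _≢_; module ≡-Reasoning)
open import Relation.Nullary using (¬_; Dec; yes; no; does)
open import Relation.Nullary.Decidable using (⌊_⌋; dec-true; dec-false; dec⇒maybe; _×-dec_)
open import Tactic.RingSolver using (solve-∀)
open import Tactic.RingSolver.Core.AlmostCommutativeRing using (AlmostCommutativeRing; fromCommutativeRing)
open import Algebra.Properties.CommutativeMonoid.Sum ℕP.+-0-commutativeMonoid
  using (sum-syntax; sum-remove; ∑-distrib-+; sum-cong-≗; sum-replicate-zero) renaming (sum to ∑)

module _ {n : ℕ} where

  SameEdge-sym : {a b c d : Fin n} → SameEdge (a , b) (c , d) → SameEdge (c , d) (a , b)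
  SameEdge-sym (inj₁ (refl , refl)) = inj₁ (refl , refl)
  SameEdge-sym (inj₂ (refl , refl)) = inj₂ (refl , refl)

  SameEdge-trans : {a b c d x y : Fin n} → SameEdge (a , b) (c , d) → SameEdge (c , d) (x , y) →
                   SameEdge (a , b) (x , y)
  SameEdge-trans (inj₁ (refl , refl)) (inj₁ (refl , refl)) = inj₁ (refl , refl)
  SameEdge-trans (inj₁ (refl , refl)) (inj₂ (refl , refl)) = inj₂ (refl , refl)
  SameEdge-trans (inj₂ (refl , refl)) (inj₁ (refl , refl)) = inj₂ (refl , refl)
  SameEdge-trans (inj₂ (refl , refl)) (inj₂ (refl , refl)) = inj₁ (refl , refl)

  SameEdge-cancelˡ : {x y z : Fin n} → SameEdge (x , y) (x , z) → y ≡ z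
  SameEdge-cancelˡ (inj₁ (_ , y≡z))   = y≡z
  SameEdge-cancelˡ (inj₂ (x≡z , y≡x)) = trans y≡x x≡z

  isEdge⇒SameEdge : (x y : Fin n) (e : Edge n) → isEdge x y e ≡ true → SameEdge e (x , y)
  isEdge⇒SameEdge x y (a , b) h with a F.≟ x | b F.≟ y | a F.≟ y | b F.≟ x
  ... | yes p | yes q | _     | _     = inj₁ (p , q)
  ... | yes _ | no _  | yes p | yes q = inj₂ (p , q)
  ... | no _  | _     | yes p | yes q = inj₂ (p , q)
  isEdge⇒SameEdge x y (a , b) () | yes _ | no _ | yes _ | no _
  isEdge⇒SameEdge x y (a , b) () | yes _ | no _ | no _  | _
  isEdge⇒SameEdge x y (a , b) () | no _  | _    | yes _ | no _
  isEdge⇒SameEdge x y (a , b) () | no _  | _    | no _  | _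

  ¬SameEdge⇒¬isEdge : (x y : Fin n) (e : Edge n) → ¬ SameEdge e (x , y) → isEdge x y e ≡ false
  ¬SameEdge⇒¬isEdge x y e ¬same with isEdge x y e in h
  ... | true  = ⊥-elim (¬same (isEdge⇒SameEdge x y e h))
  ... | false = refl

  isEdge-refl : (a b : Fin n) → isEdge a b (a , b) ≡ true
  isEdge-refl a b with a F.≟ a | b F.≟ b
  ... | yes _ | yes _ = refl
  ... | no a≢a | _    = ⊥-elim (a≢a refl)
  ... | yes _ | no b≢b = ⊥-elim (b≢b refl)

  isEdge-sym : (x y : Fin n) (e : Edge n) → isEdge x y e ≡ isEdge y x e
  isEdge-sym x y (a , b) = 𝔹.∨-comm (⌊ a F.≟ x ⌋ ∧ ⌊ b F.≟ y ⌋) (⌊ a F.≟ y ⌋ ∧ ⌊ b F.≟ x ⌋)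

  isEdge-swap : (x y a b : Fin n) → isEdge x y (a , b) ≡ isEdge x y (b , a)
  isEdge-swap x y a b =
    trans (cong₂ _∨_ (𝔹.∧-comm ⌊ a F.≟ x ⌋ ⌊ b F.≟ y ⌋) (𝔹.∧-comm ⌊ a F.≟ y ⌋ ⌊ b F.≟ x ⌋))
          (𝔹.∨-comm (⌊ b F.≟ y ⌋ ∧ ⌊ a F.≟ x ⌋) (⌊ b F.≟ x ⌋ ∧ ⌊ a F.≟ y ⌋))

  memb-sym : (x y : Fin n) (P : List (Edge n)) → memb x y P ≡ memb y x P
  memb-sym x y []      = refl
  memb-sym x y (e ∷ P) = cong₂ _∨_ (isEdge-sym x y e) (memb-sym x y P)

  Loopless : List (Edge n) → Set
  Loopless = All (λ e → proj₁ e ≢ proj₂ e)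

  memb-irrefl : (x : Fin n) {P : List (Edge n)} → Loopless P → memb x x P ≡ false
  memb-irrefl x []                   = refl
  memb-irrefl x {(a , b) ∷ _} (a≢b ∷ ls) =
    cong₂ _∨_ (¬SameEdge⇒¬isEdge x x (a , b) loop) (memb-irrefl x ls)
    where
    loop : ¬ SameEdge (a , b) (x , x)
    loop (inj₁ (refl , refl)) = a≢b refl
    loop (inj₂ (refl , refl)) = a≢b refl

  _∉ₑ_ : Edge n → List (Edge n) → Set
  (a , b) ∉ₑ P = memb a b P ≡ false

  ∉ₑ-∷ : {e : Edge n} {P σ : List (Edge n)} → All (λ e′ → ¬ SameEdge e e′) σ → All (_∉ₑ P) σ →
         All (_∉ₑ (e ∷ P)) σ
  ∉ₑ-∷ []                  []       = []
  ∉ₑ-∷ {e} {P} (¬same ∷ ¬sames) (m ∷ ms) =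
    cong₂ _∨_ (¬SameEdge⇒¬isEdge _ _ e ¬same) m ∷ ∉ₑ-∷ {P = P} ¬sames ms

  Fresh : List (Edge n) → Stream n → Set
  Fresh S σ = SimpleStream σ × All (_∉ₑ S) σ

  Fresh-[] : {σ : Stream n} → SimpleStream σ → Fresh [] σ
  Fresh-[] {σ} simple = simple , unseen σ
    where
    unseen : (σ : Stream n) → All (_∉ₑ []) σ
    unseen []      = []
    unseen (_ ∷ σ) = refl ∷ unseen σ

  Fresh-tail : {S : List (Edge n)} {e : Edge n} {σ : Stream n} → Fresh S (e ∷ σ) → Fresh S σ
  Fresh-tail ((_ ∷ ls , _ ∷ ds) , _ ∷ ms) = (ls , ds) , ms

  Fresh-∷ : {S : List (Edge n)} {e : Edge n} {σ : Stream n} → Fresh S (e ∷ σ) → Fresh (e ∷ S) σ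
  Fresh-∷ {S} ((_ ∷ ls , ¬sames ∷ ds) , _ ∷ ms) = (ls , ds) , ∉ₑ-∷ {P = S} ¬sames ms

  closes : List (Edge n) → Edge n → Fin n → Bool
  closes P (w , v) x = memb x v P ∧ memb x w P

  arrivals : List (Edge n) → Stream n → List (List (Edge n) × Edge n)
  arrivals P []      = []
  arrivals P (e ∷ σ) = (P , e) ∷ arrivals (e ∷ P) σ

ℚ-ring : AlmostCommutativeRing _ _
ℚ-ring = fromCommutativeRing ℚP.+-*-commutativeRing (λ x → dec⇒maybe (0ℚ ℚP.≟ x))

mix : ℚ → ℚ → ℚ → ℚ
mix α x y = α * x + (1ℚ - α) * y

mix-idem : ∀ α x → mix α x x ≡ x
mix-idem = ring
  where
  ring : ∀ α x → α * x + (1ℚ - α) * x ≡ x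
  ring = solve-∀ ℚ-ring

mix-+ : ∀ α x y x′ y′ → mix α x y + mix α x′ y′ ≡ mix α (x + x′) (y + y′)
mix-+ = ring
  where
  ring : ∀ α x y x′ y′ → (α * x + (1ℚ - α) * y) + (α * x′ + (1ℚ - α) * y′)
                         ≡ α * (x + x′) + (1ℚ - α) * (y + y′)
  ring = solve-∀ ℚ-ring

mix-+ʳ : ∀ α x y k → mix α (x + k) (y + k) ≡ mix α x y + k
mix-+ʳ = ring
  where
  ring : ∀ α x y k → α * (x + k) + (1ℚ - α) * (y + k) ≡ (α * x + (1ℚ - α) * y) + k
  ring = solve-∀ ℚ-ring

*-affineˡ : ∀ α s t → s * (α * t) ≡ mix α (s * (1ℚ * t)) (s * (0ℚ * t))
*-affineˡ = ring
  where
  ring : ∀ α s t → s * (α * t) ≡ α * (s * (1ℚ * t)) + (1ℚ - α) * (s * (0ℚ * t))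
  ring = solve-∀ ℚ-ring

*-affineʳ : ∀ α s t → s * (t * α) ≡ mix α (s * (t * 1ℚ)) (s * (t * 0ℚ))
*-affineʳ = ring
  where
  ring : ∀ α s t → s * (t * α) ≡ α * (s * (t * 1ℚ)) + (1ℚ - α) * (s * (t * 0ℚ))
  ring = solve-∀ ℚ-ring

module _ {A : Set} where

  sumℚ-+ : (xs : List A) (g h : A → ℚ) →
           sumℚ (map (λ x → g x + h x) xs) ≡ sumℚ (map g xs) + sumℚ (map h xs)
  sumℚ-+ []       g h = refl
  sumℚ-+ (x ∷ xs) g h = trans (cong (_+_ (g x + h x)) (sumℚ-+ xs g h))
                              (+-interchange (g x) (h x) (sumℚ (map g xs)) (sumℚ (map h xs)))
    where
    +-interchange : ∀ a b c d → (a + b) + (c + d) ≡ (a + c) + (b + d)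
    +-interchange = interchange (CommutativeMonoid.commutativeSemigroup ℚP.+-0-commutativeMonoid)

  sumℚ-*ˡ : (xs : List A) (a : ℚ) (h : A → ℚ) → sumℚ (map (λ x → a * h x) xs) ≡ a * sumℚ (map h xs)
  sumℚ-*ˡ []       a h = sym (ℚP.*-zeroʳ a)
  sumℚ-*ˡ (x ∷ xs) a h =
    trans (cong (_+_ (a * h x)) (sumℚ-*ˡ xs a h)) (sym (ℚP.*-distribˡ-+ a (h x) (sumℚ (map h xs))))

  sumℚ-mix : (xs : List A) (α : ℚ) (g h : A → ℚ) →
             sumℚ (map (λ x → mix α (g x) (h x)) xs) ≡ mix α (sumℚ (map g xs)) (sumℚ (map h xs))
  sumℚ-mix xs α g h =
    trans (sumℚ-+ xs _ _) (cong₂ _+_ (sumℚ-*ˡ xs α g) (sumℚ-*ˡ xs (1ℚ - α) h))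

EBern-cong : ∀ q m {h k : Vec Bool m → ℚ} → (∀ g → h g ≡ k g) → EBern q m h ≡ EBern q m k
EBern-cong q ℕ.zero    h≗k = h≗k []
EBern-cong q (ℕ.suc m) h≗k =
  cong₂ (mix q) (EBern-cong q m (h≗k ∘ (true ∷_))) (EBern-cong q m (h≗k ∘ (false ∷_)))

EBern-+ʳ : ∀ q m (h : Vec Bool m → ℚ) k → EBern q m (λ g → h g + k) ≡ EBern q m h + k
EBern-+ʳ q ℕ.zero    h k = refl
EBern-+ʳ q (ℕ.suc m) h k =
  trans (cong₂ (mix q) (EBern-+ʳ q m (h ∘ (true ∷_)) k) (EBern-+ʳ q m (h ∘ (false ∷_)) k))
        (mix-+ʳ q _ _ k)

-- Averaging over the coins g, for fixed f and increment c

module Coins {n : ℕ} (c q : ℚ) (f : Fin n → Bool) where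

  Weights : Set
  Weights = Fin n → Fin n → ℚ

  _[_]≔_ : Weights → Edge n → ℚ → Weights
  (W [ e ]≔ α) x y = if isEdge x y e then α else W x y

  apexWeight : Fin n → ℚ
  apexWeight x = if f x then c else 0ℚ

  wedge : Weights → Edge n → Fin n → ℚ
  wedge W (w , v) x = apexWeight x * (W x v * W x w)

  gain : Weights → Edge n → ℚ
  gain W e = sumℚ (map (wedge W e) (allFin n))

  admitProb : Edge n → ℚ
  admitProb (w , v) = if f w ∨ f v then q else 0ℚ

  -- The expected remaining output when each edge xy is in S independently with probability W x y.
  expected : Weights → Stream n → ℚ
  expected W []      = 0ℚ
  expected W (e ∷ σ) = gain W e + expected (W [ e ]≔ admitProb e) σ

  expected-cong : ∀ σ {W W′ : Weights} → (∀ x y → W x y ≡ W′ x y) → expected W σ ≡ expected W′ σ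
  expected-cong []            W≗W′ = refl
  expected-cong ((w , v) ∷ σ) W≗W′ =
    cong₂ _+_ (cong sumℚ (LP.map-cong (λ x → cong₂ (λ s t → apexWeight x * (s * t)) (W≗W′ x v) (W≗W′ x w))
                                      (allFin n)))
              (expected-cong σ (λ x y → cong (if isEdge x y (w , v) then admitProb (w , v) else_) (W≗W′ x y)))

  ≔-comm : ∀ W {e e′} α α′ → ¬ SameEdge e e′ →
           ∀ x y → ((W [ e ]≔ α) [ e′ ]≔ α′) x y ≡ ((W [ e′ ]≔ α′) [ e ]≔ α) x y
  ≔-comm W {e} {e′} α α′ ¬same x y with isEdge x y e′ in h′ | isEdge x y e in h
  ... | true  | true  =
    ⊥-elim (¬same (SameEdge-trans (isEdge⇒SameEdge x y e h) (SameEdge-sym (isEdge⇒SameEdge x y e′ h′))))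
  ... | true  | false = refl
  ... | false | true  = refl
  ... | false | false = refl

  wedge-affine : ∀ W e α {w v} → w ≢ v → ∀ x →
    wedge (W [ e ]≔ α) (w , v) x ≡ mix α (wedge (W [ e ]≔ 1ℚ) (w , v) x) (wedge (W [ e ]≔ 0ℚ) (w , v) x)
  wedge-affine W e α {w} {v} w≢v x with isEdge x v e in h₁ | isEdge x w e in h₂
  ... | true  | true  = ⊥-elim (w≢v (sym (SameEdge-cancelˡ
                          (SameEdge-trans (SameEdge-sym (isEdge⇒SameEdge x v e h₁)) (isEdge⇒SameEdge x w e h₂)))))
  ... | true  | false = *-affineˡ α (apexWeight x) (W x w)
  ... | false | true  = *-affineʳ α (apexWeight x) (W x v)
  ... | false | false = sym (mix-idem α _)

  expected-affine : ∀ σ W e α → Loopless σ → All (λ e′ → ¬ SameEdge e e′) σ →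
    expected (W [ e ]≔ α) σ ≡ mix α (expected (W [ e ]≔ 1ℚ) σ) (expected (W [ e ]≔ 0ℚ) σ)
  expected-affine []               W e α _          _                = sym (mix-idem α 0ℚ)
  expected-affine (e′@(w , v) ∷ σ) W e α (w≢v ∷ ls) (¬same ∷ ¬sames) = begin
      gain (W [ e ]≔ α) e′ + expected ((W [ e ]≔ α) [ e′ ]≔ β) σ
    ≡⟨ cong₂ _+_ gain-affine
         (trans (expected-cong σ (≔-comm W α β ¬same)) (expected-affine σ (W [ e′ ]≔ β) e α ls ¬sames)) ⟩
      mix α (gain (W [ e ]≔ 1ℚ) e′) (gain (W [ e ]≔ 0ℚ) e′)
        + mix α (expected ((W [ e′ ]≔ β) [ e ]≔ 1ℚ) σ) (expected ((W [ e′ ]≔ β) [ e ]≔ 0ℚ) σ)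
    ≡⟨ cong₂ (λ s t → mix α (gain (W [ e ]≔ 1ℚ) e′) (gain (W [ e ]≔ 0ℚ) e′) + mix α s t)
         (expected-cong σ (λ x y → sym (≔-comm W 1ℚ β ¬same x y)))
         (expected-cong σ (λ x y → sym (≔-comm W 0ℚ β ¬same x y))) ⟩
      mix α (gain (W [ e ]≔ 1ℚ) e′) (gain (W [ e ]≔ 0ℚ) e′)
        + mix α (expected ((W [ e ]≔ 1ℚ) [ e′ ]≔ β) σ) (expected ((W [ e ]≔ 0ℚ) [ e′ ]≔ β) σ)
    ≡⟨ mix-+ α _ _ _ _ ⟩
      mix α (expected (W [ e ]≔ 1ℚ) (e′ ∷ σ)) (expected (W [ e ]≔ 0ℚ) (e′ ∷ σ))
    ∎
    where
    open ≡-Reasoning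
    β : ℚ
    β = admitProb e′
    gain-affine : gain (W [ e ]≔ α) e′ ≡ mix α (gain (W [ e ]≔ 1ℚ) e′) (gain (W [ e ]≔ 0ℚ) e′)
    gain-affine = trans (cong sumℚ (LP.map-cong (wedge-affine W e α w≢v) (allFin n)))
                        (sumℚ-mix (allFin n) α _ _)

  indicator : List (Edge n) → Weights
  indicator S x y = if memb x y S then 1ℚ else 0ℚ

  indicator-∷ : ∀ S e x y → (indicator S [ e ]≔ 1ℚ) x y ≡ indicator (e ∷ S) x y
  indicator-∷ S e x y with isEdge x y e
  ... | true  = refl
  ... | false = refl

  indicator-≔0 : ∀ S {w v} → (w , v) ∉ₑ S → ∀ x y → (indicator S [ (w , v) ]≔ 0ℚ) x y ≡ indicator S x y
  indicator-≔0 S {w} {v} ∉S x y with isEdge x y (w , v) in h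
  ... | false = refl
  ... | true with isEdge⇒SameEdge x y (w , v) h
  ...   | inj₁ (refl , refl) rewrite ∉S = refl
  ...   | inj₂ (refl , refl) rewrite memb-sym v w S | ∉S = refl

  admit : Bool → Edge n → List (Edge n) → List (Edge n)
  admit b (w , v) S = if b ∧ (f w ∨ f v) then (w , v) ∷ S else S

  increment : List (Edge n) → Edge n → ℚ
  increment S (w , v) = sumℚ (map (λ u → if f u ∧ memb u v S ∧ memb u w S then c else 0ℚ) (allFin n))

  gain-indicator : ∀ S e → gain (indicator S) e ≡ increment S e
  gain-indicator S (w , v) = cong sumℚ (LP.map-cong wedge-indicator (allFin n))
    where
    wedge-indicator : ∀ u → wedge (indicator S) (w , v) u ≡ (if f u ∧ memb u v S ∧ memb u w S then c else 0ℚ)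
    wedge-indicator u with f u
    ... | false = ℚP.*-zeroˡ (indicator S u v * indicator S u w)
    ... | true with memb u v S | memb u w S
    ...   | true  | true  = ℚP.*-identityʳ c
    ...   | true  | false = ℚP.*-zeroʳ c
    ...   | false | m     = trans (cong (c *_) (ℚP.*-zeroˡ (if m then 1ℚ else 0ℚ))) (ℚP.*-zeroʳ c)

  outputFrom : List (Edge n) → (σ : Stream n) → Vec Bool (length σ) → ℚ
  outputFrom S σ g = proj₂ (run c f σ g (S , 0ℚ))

  run-shift : ∀ σ g S T → proj₂ (run c f σ g (S , T)) ≡ outputFrom S σ g + T
  run-shift []      []      S T = sym (ℚP.+-identityˡ T)
  run-shift (e ∷ σ) (b ∷ g) S T = begin
      proj₂ (run c f σ g (admit b e S , increment S e + T))
    ≡⟨ run-shift σ g (admit b e S) (increment S e + T) ⟩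
      outputFrom (admit b e S) σ g + (increment S e + T)
    ≡⟨ sym (ℚP.+-assoc (outputFrom (admit b e S) σ g) (increment S e) T) ⟩
      (outputFrom (admit b e S) σ g + increment S e) + T
    ≡⟨ cong (_+ T) (trans (cong (_+_ (outputFrom (admit b e S) σ g)) (sym (ℚP.+-identityʳ (increment S e))))
                          (sym (run-shift σ g (admit b e S) (increment S e + 0ℚ)))) ⟩
      outputFrom S (e ∷ σ) (b ∷ g) + T
    ∎
    where open ≡-Reasoning

  outputFrom-∷ : ∀ S e σ b g → outputFrom S (e ∷ σ) (b ∷ g) ≡ outputFrom (admit b e S) σ g + increment S e
  outputFrom-∷ S e σ b g = trans (run-shift σ g (admit b e S) (increment S e + 0ℚ))
                                 (cong (_+_ (outputFrom (admit b e S) σ g)) (ℚP.+-identityʳ (increment S e)))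

  Fresh-admit : ∀ {S e σ} b → Fresh S (e ∷ σ) → Fresh (admit b e S) σ
  Fresh-admit {S} {w , v} b fresh with b ∧ (f w ∨ f v)
  ... | true  = Fresh-∷ {S = S} fresh
  ... | false = Fresh-tail {S = S} fresh

  admission-mix : ∀ S e σ → Fresh S (e ∷ σ) →
    mix q (expected (indicator (admit true e S)) σ) (expected (indicator S) σ)
      ≡ expected (indicator S [ e ]≔ admitProb e) σ
  admission-mix S e@(w , v) σ ((_ ∷ ls , ¬sames ∷ _) , ∉S ∷ _) with f w ∨ f v
  ... | true  = begin
      mix q (expected (indicator (e ∷ S)) σ) (expected (indicator S) σ)
    ≡⟨ cong₂ (mix q) (expected-cong σ (λ x y → sym (indicator-∷ S e x y)))
                     (expected-cong σ (λ x y → sym (indicator-≔0 S ∉S x y))) ⟩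
      mix q (expected (indicator S [ e ]≔ 1ℚ) σ) (expected (indicator S [ e ]≔ 0ℚ) σ)
    ≡⟨ sym (expected-affine σ (indicator S) e q ls ¬sames) ⟩
      expected (indicator S [ e ]≔ q) σ
    ∎
    where open ≡-Reasoning
  ... | false = trans (mix-idem q _) (expected-cong σ (λ x y → sym (indicator-≔0 S ∉S x y)))

  EBern-outputFrom : ∀ σ S → Fresh S σ → EBern q (length σ) (outputFrom S σ) ≡ expected (indicator S) σ
  EBern-outputFrom []      S _     = refl
  EBern-outputFrom (e ∷ σ) S fresh = begin
      mix q (EBern q (length σ) (outputFrom S (e ∷ σ) ∘ (true ∷_)))
            (EBern q (length σ) (outputFrom S (e ∷ σ) ∘ (false ∷_)))
    ≡⟨ cong₂ (mix q) (coin true) (coin false) ⟩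
      mix q (expected (indicator (admit true e S)) σ + increment S e) (expected (indicator S) σ + increment S e)
    ≡⟨ mix-+ʳ q _ _ _ ⟩
      mix q (expected (indicator (admit true e S)) σ) (expected (indicator S) σ) + increment S e
    ≡⟨ cong₂ _+_ (admission-mix S e σ fresh) (sym (gain-indicator S e)) ⟩
      expected (indicator S [ e ]≔ admitProb e) σ + gain (indicator S) e
    ≡⟨ ℚP.+-comm (expected (indicator S [ e ]≔ admitProb e) σ) (gain (indicator S) e) ⟩
      expected (indicator S) (e ∷ σ)
    ∎
    where
    open ≡-Reasoning
    coin : ∀ b → EBern q (length σ) (outputFrom S (e ∷ σ) ∘ (b ∷_))
                   ≡ expected (indicator (admit b e S)) σ + increment S e
    coin b = begin
        EBern q (length σ) (outputFrom S (e ∷ σ) ∘ (b ∷_))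
      ≡⟨ EBern-cong q (length σ) (outputFrom-∷ S e σ b) ⟩
        EBern q (length σ) (λ g → outputFrom (admit b e S) σ g + increment S e)
      ≡⟨ EBern-+ʳ q (length σ) (outputFrom (admit b e S) σ) (increment S e) ⟩
        EBern q (length σ) (outputFrom (admit b e S) σ) + increment S e
      ≡⟨ cong (_+ increment S e) (EBern-outputFrom σ (admit b e S) (Fresh-admit b fresh)) ⟩
        expected (indicator (admit b e S)) σ + increment S e
      ∎

  survival : List (Edge n) → Weights
  survival P x y = if memb x y P then (if f x ∨ f y then q else 0ℚ) else 0ℚ

  survival-∷ : ∀ P w v x y → (survival P [ (w , v) ]≔ admitProb (w , v)) x y ≡ survival ((w , v) ∷ P) x y
  survival-∷ P w v x y with isEdge x y (w , v) in h
  ... | false = refl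
  ... | true with isEdge⇒SameEdge x y (w , v) h
  ...   | inj₁ (refl , refl) = refl
  ...   | inj₂ (refl , refl) = cong (if_then q else 0ℚ) (𝔹.∨-comm (f y) (f x))

  apexGain : List (Edge n) → Edge n → Fin n → ℚ
  apexGain P e x = if closes P e x then (if f x then c * (q * q) else 0ℚ) else 0ℚ

  arrivalGain : List (Edge n) × Edge n → ℚ
  arrivalGain (P , e) = sumℚ (map (apexGain P e) (allFin n))

  wedge-survival : ∀ P e x → wedge (survival P) e x ≡ apexGain P e x
  wedge-survival P (w , v) x with f x
  ... | false = trans (ℚP.*-zeroˡ (weight v * weight w)) (sym (𝔹.if-eta (closes P (w , v) x)))
    where
    weight : Fin n → ℚ
    weight y = if memb x y P then (if f y then q else 0ℚ) else 0ℚ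
  ... | true with memb x v P | memb x w P
  ...   | true  | true  = refl
  ...   | true  | false = trans (cong (c *_) (ℚP.*-zeroʳ q)) (ℚP.*-zeroʳ c)
  ...   | false | m     = trans (cong (c *_) (ℚP.*-zeroˡ (if m then q else 0ℚ))) (ℚP.*-zeroʳ c)

  expected-survival : ∀ σ P → expected (survival P) σ ≡ sumℚ (map arrivalGain (arrivals P σ))
  expected-survival []            P = refl
  expected-survival ((w , v) ∷ σ) P =
    cong₂ _+_ (cong sumℚ (LP.map-cong (wedge-survival P (w , v)) (allFin n)))
              (trans (expected-cong σ (survival-∷ P w v)) (expected-survival σ ((w , v) ∷ P)))

  EBern-output : ∀ {σ} → SimpleStream σ →
                 EBern q (length σ) (output c f σ) ≡ sumℚ (map arrivalGain (arrivals [] σ))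
  EBern-output {σ} simple = trans (EBern-outputFrom σ [] (Fresh-[] simple)) (expected-survival σ [])

-- Averaging over the vertex bits f

module _ {n : ℕ} (D : Dist n) where

  EDist-cong : {g h : (Fin n → Bool) → ℚ} → (∀ f → g f ≡ h f) → EDist D g ≡ EDist D h
  EDist-cong g≗h = cong sumℚ (LP.map-cong (λ wf → cong (proj₁ wf *_) (g≗h (proj₂ wf))) D)

  EDist-+ : (g h : (Fin n → Bool) → ℚ) → EDist D (λ f → g f + h f) ≡ EDist D g + EDist D h
  EDist-+ g h =
    trans (cong sumℚ (LP.map-cong (λ (w , f) → ℚP.*-distribˡ-+ w (g f) (h f)) D)) (sumℚ-+ D _ _)

  EDist-0 : EDist D (λ _ → 0ℚ) ≡ 0ℚ
  EDist-0 = trans (cong sumℚ (LP.map-cong (λ wf → ℚP.*-zeroʳ (proj₁ wf)) D))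
                  (trans (sumℚ-*ˡ D 0ℚ (λ _ → 0ℚ)) (ℚP.*-zeroˡ (sumℚ (map (λ _ → 0ℚ) D))))

  EDist-sum : {A : Set} (xs : List A) (h : (Fin n → Bool) → A → ℚ) →
              EDist D (λ f → sumℚ (map (h f) xs)) ≡ sumℚ (map (λ x → EDist D (λ f → h f x)) xs)
  EDist-sum []       h = EDist-0
  EDist-sum (x ∷ xs) h = trans (EDist-+ (λ f → h f x) (λ f → sumℚ (map (h f) xs)))
                               (cong (_+_ (EDist D (λ f → h f x))) (EDist-sum xs h))

  EDist-bit : ∀ x k → EDist D (λ f → if f x then k else 0ℚ) ≡ k * Pr D (λ f → f x)
  EDist-bit x k = trans (cong sumℚ (LP.map-cong (λ wf → weighted (proj₂ wf x) (proj₁ wf)) D))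
                        (sumℚ-*ˡ D k (λ wf → if proj₂ wf x then proj₁ wf else 0ℚ))
    where
    weighted : ∀ b w → w * (if b then k else 0ℚ) ≡ k * (if b then w else 0ℚ)
    weighted true  w = ℚP.*-comm w k
    weighted false w = trans (ℚP.*-zeroʳ w) (sym (ℚP.*-zeroʳ k))

𝟙 : Bool → ℕ
𝟙 true  = 1
𝟙 false = 0

𝟙-∧³-absurd : ∀ b₁ b₂ b₃ r → (b₁ ≡ true → b₂ ≡ true → b₃ ≡ true → ⊥) → 𝟙 (b₁ ∧ b₂ ∧ b₃ ∧ r) ≡ 0
𝟙-∧³-absurd true  true  true  r absurd = ⊥-elim (absurd refl refl refl)
𝟙-∧³-absurd false _     _     _ _      = refl
𝟙-∧³-absurd true  false _     _ _      = refl
𝟙-∧³-absurd true  true  false _ _      = refl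

-- Side i of a triangle is present if it is the new edge (eᵢ) or an old one (aᵢ); at most one side is new.
𝟙-∨³ : ∀ e₁ e₂ e₃ a₁ a₂ a₃ →
       (e₁ ≡ true → a₁ ≡ false) → (e₂ ≡ true → a₂ ≡ false) → (e₃ ≡ true → a₃ ≡ false) →
       (e₁ ≡ true → e₂ ≡ true → ⊥) → (e₁ ≡ true → e₃ ≡ true → ⊥) → (e₂ ≡ true → e₃ ≡ true → ⊥) →
       𝟙 ((e₁ ∨ a₁) ∧ (e₂ ∨ a₂) ∧ (e₃ ∨ a₃))
         ≡ 𝟙 (a₁ ∧ a₂ ∧ a₃) ℕ.+ (𝟙 (e₁ ∧ a₂ ∧ a₃) ℕ.+ 𝟙 (e₂ ∧ a₁ ∧ a₃) ℕ.+ 𝟙 (e₃ ∧ a₁ ∧ a₂))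
𝟙-∨³ false false false a₁ a₂ a₃ _ _ _ _ _ _ = sym (ℕP.+-identityʳ _)
𝟙-∨³ true false false a₁ a₂ a₃ new₁ _ _ _ _ _
  rewrite new₁ refl = sym (trans (ℕP.+-identityʳ _) (ℕP.+-identityʳ _))
𝟙-∨³ false true false a₁ a₂ a₃ _ new₂ _ _ _ _
  rewrite new₂ refl | 𝔹.∧-zeroʳ a₁ = sym (ℕP.+-identityʳ _)
𝟙-∨³ false false true a₁ a₂ a₃ _ _ new₃ _ _ _
  rewrite new₃ refl | 𝔹.∧-identityʳ a₂ | 𝔹.∧-zeroʳ a₂ | 𝔹.∧-zeroʳ a₁ = refl
𝟙-∨³ true  true  _    _ _ _ _ _ _ one₁₂ _     _     = ⊥-elim (one₁₂ refl refl)
𝟙-∨³ true  false true _ _ _ _ _ _ _     one₁₃ _     = ⊥-elim (one₁₃ refl refl)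
𝟙-∨³ false true  true _ _ _ _ _ _ _     _     one₂₃ = ⊥-elim (one₂₃ refl refl)

𝟙-partition : ∀ l₁ l₂ l₃ l₄ α β → (α ≡ true → β ≡ true → 𝟙 l₁ ℕ.+ 𝟙 l₂ ℕ.+ 𝟙 (l₃ ∧ l₄) ≡ 1) →
              𝟙 (l₁ ∧ β ∧ α) ℕ.+ 𝟙 (l₂ ∧ α ∧ β) ℕ.+ 𝟙 (l₃ ∧ l₄ ∧ α ∧ β) ≡ 𝟙 (β ∧ α)
𝟙-partition l₁ l₂ l₃ l₄ true true one
  rewrite 𝔹.∧-identityʳ l₁ | 𝔹.∧-identityʳ l₂ | 𝔹.∧-identityʳ l₄ = one refl refl
𝟙-partition l₁ l₂ l₃ l₄ true false _
  rewrite 𝔹.∧-zeroʳ l₁ | 𝔹.∧-zeroʳ l₂ | 𝔹.∧-zeroʳ l₄ | 𝔹.∧-zeroʳ l₃ = refl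
𝟙-partition l₁ l₂ l₃ l₄ false true _
  rewrite 𝔹.∧-zeroʳ l₁ | 𝔹.∧-zeroʳ l₂ | 𝔹.∧-zeroʳ l₄ | 𝔹.∧-zeroʳ l₃ = refl
𝟙-partition l₁ l₂ l₃ l₄ false false _
  rewrite 𝔹.∧-zeroʳ l₁ | 𝔹.∧-zeroʳ l₂ | 𝔹.∧-zeroʳ l₄ | 𝔹.∧-zeroʳ l₃ = refl

∑-zero : ∀ {n} {h : Fin n → ℕ} → (∀ x → h x ≡ 0) → ∑[ x < n ] h x ≡ 0
∑-zero {n} h≗0 = trans (sum-cong-≗ h≗0) (sum-replicate-zero n)

∑-δ : ∀ {n} (h : Fin n → ℕ) (a : Fin n) → (∀ x → x ≢ a → h x ≡ 0) → ∑[ x < n ] h x ≡ h a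
∑-δ {ℕ.suc _} h a h≗0 =
  trans (sum-remove {i = a} h)
        (trans (cong (h a ℕ.+_) (∑-zero (λ j → h≗0 _ (FP.punchInᵢ≢i a j)))) (ℕP.+-identityʳ (h a)))

sum-tabulate : ∀ {n} (h : Fin n → ℕ) → sum (tabulate h) ≡ ∑[ x < n ] h x
sum-tabulate {ℕ.zero}  h = refl
sum-tabulate {ℕ.suc n} h = cong (h F.zero ℕ.+_) (sum-tabulate (h ∘ F.suc))

sum-map-allFin : ∀ {n} (h : Fin n → ℕ) → sum (map h (allFin n)) ≡ ∑[ x < n ] h x
sum-map-allFin {n} h = trans (cong sum (LP.map-tabulate (λ x → x) h)) (sum-tabulate h)

Σ³ : ∀ {n} → (Fin n → Fin n → Fin n → ℕ) → ℕ
Σ³ {n} F = ∑[ u < n ] ∑[ v < n ] ∑[ w < n ] F u v w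

sum³-map-allFin : ∀ {n} (F : Fin n → Fin n → Fin n → ℕ) →
  sum (map (λ u → sum (map (λ v → sum (map (F u v) (allFin n))) (allFin n))) (allFin n)) ≡ Σ³ F
sum³-map-allFin {n} F =
  trans (sum-map-allFin (λ u → sum (map (λ v → sum (map (F u v) (allFin n))) (allFin n))))
        (sum-cong-≗ (λ u → trans (sum-map-allFin (λ v → sum (map (F u v) (allFin n))))
                                 (sum-cong-≗ (λ v → sum-map-allFin (F u v)))))

Σ³-cong : ∀ {n} {F G : Fin n → Fin n → Fin n → ℕ} → (∀ u v w → F u v w ≡ G u v w) → Σ³ F ≡ Σ³ G
Σ³-cong F≗G = sum-cong-≗ (λ u → sum-cong-≗ (λ v → sum-cong-≗ (F≗G u v)))

Σ³-+ : ∀ {n} (F G : Fin n → Fin n → Fin n → ℕ) → Σ³ (λ u v w → F u v w ℕ.+ G u v w) ≡ Σ³ F ℕ.+ Σ³ G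
Σ³-+ {n} F G =
  trans (sum-cong-≗ (λ u → trans (sum-cong-≗ (λ v → ∑-distrib-+ (F u v) (G u v)))
                                 (∑-distrib-+ (λ v → ∑[ w < n ] F u v w) (λ v → ∑[ w < n ] G u v w))))
        (∑-distrib-+ (λ u → ∑[ v < n ] ∑[ w < n ] F u v w) (λ u → ∑[ v < n ] ∑[ w < n ] G u v w))

length-filter : {A : Set} {P : A → Set} (P? : ∀ x → Dec (P x)) (xs : List A) →
                length (filter P? xs) ≡ sum (map (𝟙 ∘ does ∘ P?) xs)
length-filter P? []       = refl
length-filter P? (x ∷ xs) with does (P? x)
... | true  = cong ℕ.suc (length-filter P? xs)
... | false = length-filter P? xs

sum-cartesianProduct : {A B : Set} (xs : List A) (ys : List B) (h : A × B → ℕ) →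
  sum (map h (cartesianProduct xs ys)) ≡ sum (map (λ x → sum (map (λ y → h (x , y)) ys)) xs)
sum-cartesianProduct []       ys h = refl
sum-cartesianProduct (x ∷ xs) ys h =
  trans (cong sum (LP.map-++ h (map (x ,_) ys) (cartesianProduct xs ys)))
        (trans (ℕL.sum-++ (map h (map (x ,_) ys)) (map h (cartesianProduct xs ys)))
               (cong₂ ℕ._+_ (cong sum (sym (LP.map-∘ ys))) (sum-cartesianProduct xs ys h)))

-- Counting triangles edge by edge

module _ {n : ℕ} where

  _<ᵇ_ : Fin n → Fin n → Bool
  x <ᵇ y = does (x F.<? y)

  <ᵇ⇒< : ∀ x y → x <ᵇ y ≡ true → x F.< y
  <ᵇ⇒< x y = witness (x F.<? y)
    where
    witness : ∀ {P : Set} (P? : Dec P) → does P? ≡ true → P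
    witness (yes p) _ = p

  <ᵇ-true : ∀ x y → x F.< y → x <ᵇ y ≡ true
  <ᵇ-true x y = dec-true (x F.<? y)

  <ᵇ-false : ∀ x y → ¬ x F.< y → x <ᵇ y ≡ false
  <ᵇ-false x y = dec-false (x F.<? y)

  <ᵇ-trans : ∀ x y z → x <ᵇ y ≡ true → y <ᵇ z ≡ true → x <ᵇ z ≡ true
  <ᵇ-trans x y z x<y y<z = <ᵇ-true x z (FP.<-trans (<ᵇ⇒< x y x<y) (<ᵇ⇒< y z y<z))

  isTriangle : (Fin n → Fin n → Bool) → Fin n → Fin n → Fin n → Bool
  isTriangle A u v w = u <ᵇ v ∧ v <ᵇ w ∧ A u v ∧ A v w ∧ A u w

  triangleCount : (Fin n → Fin n → Bool) → ℕ
  triangleCount A = Σ³ (λ u v w → 𝟙 (isTriangle A u v w))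

  codegree : (Fin n → Fin n → Bool) → Edge n → ℕ
  codegree A (a , b) = ∑[ x < n ] 𝟙 (A x b ∧ A x a)

  triangleCount-cong : ∀ {A A′ : Fin n → Fin n → Bool} → (∀ x y → A x y ≡ A′ x y) →
                       triangleCount A ≡ triangleCount A′
  triangleCount-cong A≗A′ = Σ³-cong (λ u v w →
    cong 𝟙 (cong₂ (λ s t → u <ᵇ v ∧ v <ᵇ w ∧ s ∧ t) (A≗A′ u v) (cong₂ _∧_ (A≗A′ v w) (A≗A′ u w))))

  triangleCount-empty : triangleCount (λ _ _ → false) ≡ 0
  triangleCount-empty = ∑-zero (λ u → ∑-zero (λ v → ∑-zero (λ w →
    𝟙-∧³-absurd (u <ᵇ v) (v <ᵇ w) false (false ∧ false) (λ _ _ ()))))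

  module AddOrderedEdge (A : Fin n → Fin n → Bool) (A-sym : ∀ x y → A x y ≡ A y x)
                        (A-irrefl : ∀ x → A x x ≡ false)
                        {a b : Fin n} (a<b : a F.< b) (Aab : A a b ≡ false) where

    E : Fin n → Fin n → Bool
    E x y = isEdge x y (a , b)

    edge-ends : ∀ x y → x <ᵇ y ≡ true → E x y ≡ true → x ≡ a × y ≡ b
    edge-ends x y x<y e with isEdge⇒SameEdge x y (a , b) e
    ... | inj₁ (refl , refl) = refl , refl
    ... | inj₂ (refl , refl) = ⊥-elim (FP.<-asym a<b (<ᵇ⇒< x y x<y))

    A⇒≢ : ∀ {x y} → A x y ≡ true → x ≢ y
    A⇒≢ {x} h refl with trans (sym h) (A-irrefl x)
    ... | ()

    E⇒¬A : ∀ x y → x <ᵇ y ≡ true → E x y ≡ true → A x y ≡ false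
    E⇒¬A x y x<y e with edge-ends x y x<y e
    ... | refl , refl = Aab

    new₁ new₂ new₃ : Fin n → Fin n → Fin n → ℕ
    new₁ u v w = 𝟙 (u <ᵇ v ∧ v <ᵇ w ∧ E u v ∧ A v w ∧ A u w)
    new₂ u v w = 𝟙 (u <ᵇ v ∧ v <ᵇ w ∧ E v w ∧ A u v ∧ A u w)
    new₃ u v w = 𝟙 (u <ᵇ v ∧ v <ᵇ w ∧ E u w ∧ A u v ∧ A v w)

    new : Fin n → Fin n → Fin n → ℕ
    new u v w = new₁ u v w ℕ.+ new₂ u v w ℕ.+ new₃ u v w

    isTriangle-split : ∀ u v w →
                       𝟙 (isTriangle (λ x y → E x y ∨ A x y) u v w) ≡ 𝟙 (isTriangle A u v w) ℕ.+ new u v w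
    isTriangle-split u v w with u <ᵇ v in u<v | v <ᵇ w in v<w
    ... | false | _     = refl
    ... | true  | false = refl
    ... | true  | true  = 𝟙-∨³ (E u v) (E v w) (E u w) (A u v) (A v w) (A u w)
      (E⇒¬A u v u<v) (E⇒¬A v w v<w) (E⇒¬A u w u<w)
      (λ e₁ e₂ → FP.<-irrefl (trans (sym (proj₁ (edge-ends v w v<w e₂))) (proj₂ (edge-ends u v u<v e₁))) a<b)
      (λ e₁ e₃ → FP.<-irrefl (trans (proj₂ (edge-ends u v u<v e₁)) (sym (proj₂ (edge-ends u w u<w e₃))))
                             (<ᵇ⇒< v w v<w))
      (λ e₂ e₃ → FP.<-irrefl (trans (proj₁ (edge-ends u w u<w e₃)) (sym (proj₁ (edge-ends v w v<w e₂))))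
                             (<ᵇ⇒< u v u<v))
      where
      u<w : u <ᵇ w ≡ true
      u<w = <ᵇ-trans u v w u<v v<w

    ∑∑-δ : (h : Fin n → Fin n → ℕ) → (∀ x y → x ≢ a → h x y ≡ 0) → (∀ y → y ≢ b → h a y ≡ 0) →
           ∑[ x < n ] ∑[ y < n ] h x y ≡ h a b
    ∑∑-δ h off-a off-b = trans (∑-δ _ a (λ x x≢a → ∑-zero (λ y → off-a x y x≢a))) (∑-δ (h a) b off-b)

    ∑new₁ : Σ³ new₁ ≡ ∑[ x < n ] new₁ a b x
    ∑new₁ = ∑∑-δ (λ u v → ∑[ w < n ] new₁ u v w)
      (λ u v u≢a → ∑-zero (λ w → 𝟙-∧³-absurd (u <ᵇ v) (v <ᵇ w) (E u v) _
                                   (λ u<v _ e → u≢a (proj₁ (edge-ends u v u<v e)))))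
      (λ v v≢b → ∑-zero (λ w → 𝟙-∧³-absurd (a <ᵇ v) (v <ᵇ w) (E a v) _
                                 (λ a<v _ e → v≢b (proj₂ (edge-ends a v a<v e)))))

    ∑new₂ : Σ³ new₂ ≡ ∑[ x < n ] new₂ x a b
    ∑new₂ = sum-cong-≗ (λ u → ∑∑-δ (new₂ u)
      (λ v w v≢a → 𝟙-∧³-absurd (u <ᵇ v) (v <ᵇ w) (E v w) _
                     (λ _ v<w e → v≢a (proj₁ (edge-ends v w v<w e))))
      (λ w w≢b → 𝟙-∧³-absurd (u <ᵇ a) (a <ᵇ w) (E a w) _
                   (λ _ a<w e → w≢b (proj₂ (edge-ends a w a<w e)))))

    ∑new₃ : Σ³ new₃ ≡ ∑[ x < n ] new₃ a x b
    ∑new₃ = trans (∑-δ _ a (λ u u≢a → ∑-zero (λ v → ∑-zero (λ w →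
                    𝟙-∧³-absurd (u <ᵇ v) (v <ᵇ w) (E u w) _
                      (λ u<v v<w e → u≢a (proj₁ (edge-ends u w (<ᵇ-trans u v w u<v v<w) e)))))))
                  (sum-cong-≗ (λ v → ∑-δ _ b (λ w w≢b →
                    𝟙-∧³-absurd (a <ᵇ v) (v <ᵇ w) (E a w) _
                      (λ a<v v<w e → w≢b (proj₂ (edge-ends a w (<ᵇ-trans a v w a<v v<w) e))))))

    position : ∀ x → x ≢ a → x ≢ b → 𝟙 (b <ᵇ x) ℕ.+ 𝟙 (x <ᵇ a) ℕ.+ 𝟙 (a <ᵇ x ∧ x <ᵇ b) ≡ 1
    position x x≢a x≢b with FP.<-cmp x a
    ... | tri< x<a _ _ rewrite <ᵇ-false b x (FP.<-asym (FP.<-trans x<a a<b)) | <ᵇ-true x a x<a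
                             | <ᵇ-false a x (FP.<-asym x<a) = refl
    ... | tri≈ _ x≡a _ = ⊥-elim (x≢a x≡a)
    ... | tri> _ _ a<x with FP.<-cmp x b
    ...   | tri< x<b _ _ rewrite <ᵇ-false b x (FP.<-asym x<b) | <ᵇ-false x a (FP.<-asym a<x)
                               | <ᵇ-true a x a<x | <ᵇ-true x b x<b = refl
    ...   | tri≈ _ x≡b _ = ⊥-elim (x≢b x≡b)
    ...   | tri> _ _ b<x rewrite <ᵇ-true b x b<x | <ᵇ-false x a (FP.<-asym a<x)
                               | <ᵇ-true a x a<x | <ᵇ-false x b (FP.<-asym b<x) = refl

    new-at : ∀ x → new₁ a b x ℕ.+ new₂ x a b ℕ.+ new₃ a x b ≡ 𝟙 (A x b ∧ A x a)
    new-at x rewrite <ᵇ-true a b a<b | isEdge-refl a b | A-sym b x | A-sym a x =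
      𝟙-partition (b <ᵇ x) (x <ᵇ a) (a <ᵇ x) (x <ᵇ b) (A x a) (A x b)
                  (λ xa xb → position x (A⇒≢ xa) (A⇒≢ xb))

    triangleCount-addOrderedEdge :
      triangleCount (λ x y → E x y ∨ A x y) ≡ triangleCount A ℕ.+ codegree A (a , b)
    triangleCount-addOrderedEdge = begin
        triangleCount (λ x y → E x y ∨ A x y)
      ≡⟨ Σ³-cong isTriangle-split ⟩
        Σ³ (λ u v w → 𝟙 (isTriangle A u v w) ℕ.+ new u v w)
      ≡⟨ Σ³-+ (λ u v w → 𝟙 (isTriangle A u v w)) new ⟩
        triangleCount A ℕ.+ Σ³ new
      ≡⟨ cong (triangleCount A ℕ.+_) (trans (Σ³-+ _ new₃) (cong (ℕ._+ Σ³ new₃) (Σ³-+ new₁ new₂))) ⟩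
        triangleCount A ℕ.+ (Σ³ new₁ ℕ.+ Σ³ new₂ ℕ.+ Σ³ new₃)
      ≡⟨ cong (triangleCount A ℕ.+_) (cong₂ ℕ._+_ (cong₂ ℕ._+_ ∑new₁ ∑new₂) ∑new₃) ⟩
        triangleCount A ℕ.+ (∑[ x < n ] new₁ a b x ℕ.+ ∑[ x < n ] new₂ x a b ℕ.+ ∑[ x < n ] new₃ a x b)
      ≡⟨ cong (triangleCount A ℕ.+_)
              (sym (trans (∑-distrib-+ (λ x → new₁ a b x ℕ.+ new₂ x a b) (λ x → new₃ a x b))
                          (cong (ℕ._+ ∑[ x < n ] new₃ a x b) (∑-distrib-+ (new₁ a b) (λ x → new₂ x a b))))) ⟩
        triangleCount A ℕ.+ ∑[ x < n ] (new₁ a b x ℕ.+ new₂ x a b ℕ.+ new₃ a x b)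
      ≡⟨ cong (triangleCount A ℕ.+_) (sum-cong-≗ new-at) ⟩
        triangleCount A ℕ.+ codegree A (a , b)
      ∎
      where open ≡-Reasoning

  triangleCount-addEdge : ∀ A → (∀ x y → A x y ≡ A y x) → (∀ x → A x x ≡ false) →
                          ∀ {a b} → a ≢ b → A a b ≡ false →
                          triangleCount (λ x y → isEdge x y (a , b) ∨ A x y)
                            ≡ triangleCount A ℕ.+ codegree A (a , b)
  triangleCount-addEdge A A-sym A-irrefl {a} {b} a≢b Aab with FP.<-cmp a b
  ... | tri< a<b _ _ = AddOrderedEdge.triangleCount-addOrderedEdge A A-sym A-irrefl a<b Aab
  ... | tri≈ _ a≡b _ = ⊥-elim (a≢b a≡b)
  ... | tri> _ _ b<a = begin
      triangleCount (λ x y → isEdge x y (a , b) ∨ A x y)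
    ≡⟨ triangleCount-cong (λ x y → cong (_∨ A x y) (isEdge-swap x y a b)) ⟩
      triangleCount (λ x y → isEdge x y (b , a) ∨ A x y)
    ≡⟨ AddOrderedEdge.triangleCount-addOrderedEdge A A-sym A-irrefl b<a (trans (A-sym b a) Aab) ⟩
      triangleCount A ℕ.+ codegree A (b , a)
    ≡⟨ cong (triangleCount A ℕ.+_) (sum-cong-≗ (λ x → cong 𝟙 (𝔹.∧-comm (A x a) (A x b)))) ⟩
      triangleCount A ℕ.+ codegree A (a , b)
    ∎
    where open ≡-Reasoning

  codegreeAt : List (Edge n) × Edge n → ℕ
  codegreeAt (P , e) = codegree (adj P) e

  triangleCount-arrivals : ∀ σ P → Loopless P → Fresh P σ →
    triangleCount (adj P) ℕ.+ sum (map codegreeAt (arrivals P σ))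
      ≡ triangleCount (λ x y → adj σ x y ∨ adj P x y)
  triangleCount-arrivals []                P _  _ = ℕP.+-identityʳ _
  triangleCount-arrivals (e@(w , v) ∷ σ) P lP fresh@((w≢v ∷ _ , _) , ∉P ∷ _) = begin
      triangleCount (adj P) ℕ.+ (codegree (adj P) e ℕ.+ sum (map codegreeAt (arrivals (e ∷ P) σ)))
    ≡⟨ sym (ℕP.+-assoc (triangleCount (adj P)) _ _) ⟩
      (triangleCount (adj P) ℕ.+ codegree (adj P) e) ℕ.+ sum (map codegreeAt (arrivals (e ∷ P) σ))
    ≡⟨ cong (ℕ._+ sum (map codegreeAt (arrivals (e ∷ P) σ))) (sym addEdge) ⟩
      triangleCount (adj (e ∷ P)) ℕ.+ sum (map codegreeAt (arrivals (e ∷ P) σ))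
    ≡⟨ triangleCount-arrivals σ (e ∷ P) (w≢v ∷ lP) (Fresh-∷ {S = P} fresh) ⟩
      triangleCount (λ x y → adj σ x y ∨ adj (e ∷ P) x y)
    ≡⟨ triangleCount-cong (λ x y → trans (sym (𝔹.∨-assoc (adj σ x y) (isEdge x y e) (adj P x y)))
                                         (cong (_∨ adj P x y) (𝔹.∨-comm (adj σ x y) (isEdge x y e)))) ⟩
      triangleCount (λ x y → adj (e ∷ σ) x y ∨ adj P x y)
    ∎
    where
    open ≡-Reasoning
    addEdge : triangleCount (adj (e ∷ P)) ≡ triangleCount (adj P) ℕ.+ codegree (adj P) e
    addEdge = triangleCount-addEdge (adj P) (λ x y → memb-sym x y P) (λ x → memb-irrefl x lP) w≢v ∉P

  triangles≡triangleCount : ∀ σ → triangles σ ≡ triangleCount (adj σ)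
  triangles≡triangleCount σ = begin
      length (filter isTriangle? triples)
    ≡⟨ length-filter isTriangle? triples ⟩
      sum (map (𝟙 ∘ does ∘ isTriangle?) triples)
    ≡⟨ sum-cartesianProduct (allFin n) _ _ ⟩
      sum (map (λ u → sum (map (λ vw → 𝟙 (does (isTriangle? (u , vw)))) (cartesianProduct (allFin n) (allFin n))))
               (allFin n))
    ≡⟨ cong sum (LP.map-cong (λ u → sum-cartesianProduct (allFin n) (allFin n) _) (allFin n)) ⟩
      sum (map (λ u → sum (map (λ v → sum (map (λ w → 𝟙 (isTriangle (adj σ) u v w)) (allFin n))) (allFin n)))
               (allFin n))
    ≡⟨ sum³-map-allFin (λ u v w → 𝟙 (isTriangle (adj σ) u v w)) ⟩
      triangleCount (adj σ)
    ∎
    where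
    open ≡-Reasoning
    triples : List (Fin n × Fin n × Fin n)
    triples = cartesianProduct (allFin n) (cartesianProduct (allFin n) (allFin n))
    IsTriangle : Fin n × Fin n × Fin n → Set
    IsTriangle (u , v , w) = u F.< v × v F.< w × T (adj σ u v ∧ adj σ v w ∧ adj σ u w)
    isTriangle? : ∀ t → Dec (IsTriangle t)
    isTriangle? (u , v , w) = (u F.<? v) ×-dec (v F.<? w) ×-dec 𝔹.T? (adj σ u v ∧ adj σ v w ∧ adj σ u w)

  arrivals-codegree : ∀ {σ} → SimpleStream σ → sum (map codegreeAt (arrivals [] σ)) ≡ triangles σ
  arrivals-codegree {σ} simple = begin
      sum (map codegreeAt (arrivals [] σ))
    ≡⟨ cong (ℕ._+ sum (map codegreeAt (arrivals [] σ))) (sym triangleCount-empty) ⟩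
      triangleCount (adj []) ℕ.+ sum (map codegreeAt (arrivals [] σ))
    ≡⟨ triangleCount-arrivals σ [] [] (Fresh-[] simple) ⟩
      triangleCount (λ x y → adj σ x y ∨ false)
    ≡⟨ triangleCount-cong (λ x y → 𝔹.∨-identityʳ (adj σ x y)) ⟩
      triangleCount (adj σ)
    ≡⟨ sym (triangles≡triangleCount σ) ⟩
      triangles σ
    ∎
    where open ≡-Reasoning

ι : ℕ → ℚ
ι m = + m / 1

ι-+ : ∀ m k → ι (m ℕ.+ k) ≡ ι m + ι k
ι-+ m k = sym (trans (cong₂ _+_ (ι≡mkℚ m) (ι≡mkℚ k))
  (cong (_/ 1) (trans (cong₂ ℤ._+_ (ℤP.*-identityʳ (+ m)) (ℤP.*-identityʳ (+ k))) (sym (ℤP.pos-+ m k)))))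
  where
  ι≡mkℚ : ∀ m → ι m ≡ mkℚ (+ m) 0 (Coprimality.sym (Coprimality.1-coprimeTo m))
  ι≡mkℚ m = ℚP.normalize-coprime (Coprimality.sym (Coprimality.1-coprimeTo m))

sumℚ-ι : {A : Set} (xs : List A) (h : A → ℕ) → sumℚ (map (ι ∘ h) xs) ≡ ι (sum (map h xs))
sumℚ-ι []       h = refl
sumℚ-ι (x ∷ xs) h = trans (cong (_+_ (ι (h x))) (sumℚ-ι xs h)) (sym (ι-+ (h x) (sum (map h xs))))

module _ {n : ℕ} (D : Dist n) {p : ℚ} (marginals : Marginals D p) {c q : ℚ} (cq²p≡1 : c * (q * q) * p ≡ 1ℚ) where

  EDist-apexGain : ∀ P e x → EDist D (λ f → Coins.apexGain c q f P e x) ≡ ι (𝟙 (closes P e x))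
  EDist-apexGain P e x with closes P e x
  ... | true  = trans (EDist-bit D x (c * (q * q))) (trans (cong (c * (q * q) *_) (marginals x)) cq²p≡1)
  ... | false = EDist-0 D

  EDist-arrivalGain : ∀ Pe → EDist D (λ f → Coins.arrivalGain c q f Pe) ≡ ι (codegreeAt Pe)
  EDist-arrivalGain (P , e) = begin
      EDist D (λ f → sumℚ (map (Coins.apexGain c q f P e) (allFin n)))
    ≡⟨ EDist-sum D (allFin n) (λ f → Coins.apexGain c q f P e) ⟩
      sumℚ (map (λ x → EDist D (λ f → Coins.apexGain c q f P e x)) (allFin n))
    ≡⟨ cong sumℚ (LP.map-cong (EDist-apexGain P e) (allFin n)) ⟩
      sumℚ (map (ι ∘ 𝟙 ∘ closes P e) (allFin n))
    ≡⟨ sumℚ-ι (allFin n) (𝟙 ∘ closes P e) ⟩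
      ι (sum (map (𝟙 ∘ closes P e) (allFin n)))
    ≡⟨ cong ι (sum-map-allFin (𝟙 ∘ closes P e)) ⟩
      ι (codegreeAt (P , e))
    ∎
    where open ≡-Reasoning

incr-inverse : ∀ p q (p>0 : 0ℚ < p) (q>0 : 0ℚ < q) → incr p q p>0 q>0 * (q * q) * p ≡ 1ℚ
incr-inverse p q p>0 q>0 = trans (ring (incr p q p>0 q>0) p q) (ℚP.*-inverseˡ (p * q * q) {{pq²≢0}})
  where
  ring : ∀ c p q → c * (q * q) * p ≡ c * (p * q * q)
  ring = solve-∀ ℚ-ring
  instance
    _ : Positive p
    _ = positive p>0
    _ : Positive q
    _ = positive q>0
  pq²≢0 : NonZero (p * q * q)
  pq²≢0 = ℚP.pos⇒nonZero (p * q * q) {{ℚP.pos*pos⇒pos (p * q) {{ℚP.pos*pos⇒pos p q}} q}}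

lemma2 : (n : ℕ) (σ : Stream n) → SimpleStream σ →
         (p q : ℚ) (p>0 : 0ℚ < p) → p ≤ 1ℚ → (q>0 : 0ℚ < q) → q ≤ 1ℚ →
         (D : Dist n) → IsDist D → Marginals D p → PairwiseIndependent D →
         expectedOutput p q p>0 q>0 D σ ≡ (+ triangles σ) / 1
lemma2 n σ simple p q p>0 _ q>0 _ D _ marginals _ = begin
    EDist D (λ f → EBern q (length σ) (output c f σ))
  ≡⟨ EDist-cong D (λ f → Coins.EBern-output c q f simple) ⟩
    EDist D (λ f → sumℚ (map (Coins.arrivalGain c q f) (arrivals [] σ)))
  ≡⟨ EDist-sum D (arrivals [] σ) (Coins.arrivalGain c q) ⟩
    sumℚ (map (λ Pe → EDist D (λ f → Coins.arrivalGain c q f Pe)) (arrivals [] σ))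
  ≡⟨ cong sumℚ (LP.map-cong (EDist-arrivalGain D marginals {c} {q} (incr-inverse p q p>0 q>0)) (arrivals [] σ)) ⟩
    sumℚ (map (ι ∘ codegreeAt) (arrivals [] σ))
  ≡⟨ sumℚ-ι (arrivals [] σ) codegreeAt ⟩
    ι (sum (map codegreeAt (arrivals [] σ)))
  ≡⟨ cong ι (arrivals-codegree simple) ⟩
    ι (triangles σ)
  ∎
  where
  open ≡-Reasoning
  c : ℚ
  c = incr p q p>0 q>0
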